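{- For every vexillary $w\in S_n$, $A'_R(w)\subseteq D(w)$, and each row contains at most one square of $A'_R(w)$.
   Context: $w$ is vexillary if it avoids $2143$. Rothe diagram $D(w)=\{(i,j)\in[n]\times[n]:i<w^{ -1}(j),\ j<w(i)\}$ (row $i$, column $j$, rows top to bottom), rank $r(i,j)=|\{k<i:w(k)<j\}|$. Squares $(i,j),(i',j')\in D(w)$ are linked if $i-i'=r(i,j)-r(i',j')$; linking classes are the resulting equivalence classes. With $b(i,j)=|\{i'>i:(i',j)\in D(w)\}|$, the right bubbling order on $D(w)$ is $(i,j)\prec_R(i',j')$ iff $i>i'$, or $i=i'$ and $b(i,j)<b(i',j')$, or $i=i'$, $b(i,j)=b(i',j')$ and $j>j'$. $A_R(w)$: scan $D(w)$ in $\prec_R$ order starting from $\emptyset$, adding a square iff no square already added lies in the same column or in the same linking class. Sets $A'^{(i)}_R(w)$ are defined by downward recursion: $A'^{(n)}_R(w)=A_R(w)$; for $i=n,n-1,\dots,2$, if $A'^{(i)}_R(w)$ has at most one square in row $i$, set $A'^{(i-1)}_R(w)=A'^{(i)}_R(w)$; otherwise, letting $(i,j_1)\prec_R(i,j_2)\prec_R\cdots\prec_R(i,j_m)$ be its squares in row $i$, set $A'^{(i-1)}_R(w)=\big(A'^{(i)}_R(w)\setminus\{(i,j_2),\dots,(i,j_m)\}\big)\cup\{(i-1,j_2),\dots,(i-1,j_m)\}$. Finally $A'_R(w)=A'^{(1)}_R(w)$. -}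

module Defs where

open import Data.Nat using (ℕ; zero; suc; _∸_; _<ᵇ_; _≡ᵇ_; _+_)
open import Data.Bool using (Bool; true; false; _∧_; _∨_; not; if_then_else_)
open import Data.Fin using (Fin; toℕ; pred; _<_)
open import Data.Fin.Permutation using (Permutation′; _⟨$⟩ʳ_; _⟨$⟩ˡ_)
open import Data.List using (List; []; _∷_; _++_; filterᵇ; length; foldl; allFin; concatMap; map; reverse)
open import Data.Empty using (⊥)
open import Relation.Binary.PropositionalEquality using (_≡_)
open import Data.Product using (_×_; _,_; proj₁; proj₂; ∃)

-- Conventions: rows/columns are 0-indexed elements of Fin n
-- (row/column k here corresponds to k+1 in the paper); all
-- conditions are order comparisons, hence invariant under this shift.
-- A square is (row , column).

Square : ℕ → Set
Square n = Fin n × Fin n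

Vexillary : ∀ {n} → Permutation′ n → Set
Vexillary {n} w =
  (a b c d : Fin n) → a < b → b < c → c < d →
  (w ⟨$⟩ʳ b) < (w ⟨$⟩ʳ a) → (w ⟨$⟩ʳ a) < (w ⟨$⟩ʳ d) →
  (w ⟨$⟩ʳ d) < (w ⟨$⟩ʳ c) → ⊥

_<F_ : ∀ {n} → Fin n → Fin n → Bool
x <F y = toℕ x <ᵇ toℕ y

_=F_ : ∀ {n} → Fin n → Fin n → Bool
x =F y = toℕ x ≡ᵇ toℕ y

count : ∀ {A : Set} → (A → Bool) → List A → ℕ
count p xs = length (filterᵇ p xs)

inDᵇ : ∀ {n} → Permutation′ n → Square n → Bool
inDᵇ w (i , j) = (i <F (w ⟨$⟩ˡ j)) ∧ (j <F (w ⟨$⟩ʳ i))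

InD : ∀ {n} → Permutation′ n → Square n → Set
InD w s = inDᵇ w s ≡ true

D : ∀ {n} → Permutation′ n → List (Square n)
D {n} w = filterᵇ (inDᵇ w) (concatMap (λ i → map (λ j → (i , j)) (allFin n)) (allFin n))

rank : ∀ {n} → Permutation′ n → Square n → ℕ
rank {n} w (i , j) = count (λ k → (k <F i) ∧ ((w ⟨$⟩ʳ k) <F j)) (allFin n)

-- linked: i - i' = r(i,j) - r(i',j'), i.e. i + r(i',j') = i' + r(i,j).
-- This is already an equivalence relation, so "same linking class" = linked.
linkedᵇ : ∀ {n} → Permutation′ n → Square n → Square n → Bool
linkedᵇ w (i , j) (i' , j') = (toℕ i + rank w (i' , j')) ≡ᵇ (toℕ i' + rank w (i , j))

bcount : ∀ {n} → Permutation′ n → Square n → ℕ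
bcount {n} w (i , j) = count (λ i' → (i <F i') ∧ inDᵇ w (i' , j)) (allFin n)

precR : ∀ {n} → Permutation′ n → Square n → Square n → Bool
precR w s@(i , j) t@(i' , j') =
  (i' <F i) ∨ ((i =F i') ∧ ((bcount w s <ᵇ bcount w t) ∨ ((bcount w s ≡ᵇ bcount w t) ∧ (j' <F j))))

insertR : ∀ {n} → Permutation′ n → Square n → List (Square n) → List (Square n)
insertR w x [] = x ∷ []
insertR w x (y ∷ ys) = if precR w x y then x ∷ y ∷ ys else y ∷ insertR w x ys

sortR : ∀ {n} → Permutation′ n → List (Square n) → List (Square n)
sortR w [] = []
sortR w (x ∷ xs) = insertR w x (sortR w xs)

anyᵇ : ∀ {A : Set} → (A → Bool) → List A → Bool
anyᵇ p [] = false
anyᵇ p (x ∷ xs) = p x ∨ anyᵇ p xs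

A-R : ∀ {n} → Permutation′ n → List (Square n)
A-R w = foldl step [] (sortR w (D w))
  where
  step : _ → _ → _
  step acc s@(i , j) =
    if anyᵇ (λ t → (proj₂ t =F j) ∨ linkedᵇ w t s) acc then acc else acc ++ (s ∷ [])

moveRow : ∀ {n} → Permutation′ n → Fin n → List (Square n) → List (Square n)
moveRow w r A with sortR w (filterᵇ (λ s → proj₁ s =F r) A)
... | [] = A
... | _ ∷ [] = A
... | s₁ ∷ rest@(_ ∷ _) =
  filterᵇ (λ s → not (proj₁ s =F r)) A ++ (s₁ ∷ map (λ s → (pred (proj₁ s) , proj₂ s)) rest)

-- process rows n-1, n-2, …, 1 (0-indexed), i.e. paper rows n, …, 2;
-- row 0 (paper row 1) is not processed.
A'-R : ∀ {n} → Permutation′ n → List (Square n)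
A'-R {n} w = foldl step (A-R w) (reverse (allFin n))
  where
  step : List (Square n) → Fin n → List (Square n)
  step A r = if toℕ r ≡ᵇ 0 then A else moveRow w r A

{-# OPTIONS --safe #-}
module Submission where

-- Write coRank (i , j) = #{k < i : w(k) ≥ j} = i − r(i, j).  Two squares are linked exactly when
-- their coranks agree, so the greedy scan A_R(w) picks diagram squares of pairwise distinct
-- corank.  Fix a corner (p, w(p)) and a diagram square (i, j) strictly south-east of it.  For
-- k ≤ p, vexillarity (no 2143 on k < p < i < w⁻¹(j)) gives w(k) ≥ j iff w(k) > w(p), so the
-- corank of (i, j) is a constant plus #{p < k < i : w(k) ≥ j} ≤ i − p − 1.  By pigeonhole,
-- the squares of A_R(w) south-east of the corner in rows ≤ b are at most b − p; likewise A_R(w)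
-- has at most b + 1 squares in rows ≤ b.
--
-- These block bounds survive the passage from row x to row x − 1.  Inside row x vexillarity
-- gives every square east of w(x − 1) a b-statistic no larger than that of any square west of
-- it, so the right bubbling order lists the eastern squares first.  The block of the corner
-- (x − 1, w(x − 1)) restricted to row x holds at most one square, hence only the first square of
-- the row can lie east of w(x − 1): all moved squares lie west of it and stay in D(w).  Once row
-- 0 is reached, the bound for rows ≤ 0 leaves at most one square in the top row as well.

open import Defs
open import Data.Bool using (Bool; true; false; _∧_; _∨_; not; if_then_else_; T)
open import Data.Bool.Properties using (T-∧; T-∨; T-≡)
open import Data.Empty using (⊥; ⊥-elim)
open import Data.Fin using (Fin; toℕ; fromℕ<; pred) renaming (zero to fzero; suc to fsuc)
import Data.Fin as Fin
open import Data.Fin.Permutation using (Permutation′; _⟨$⟩ʳ_; _⟨$⟩ˡ_; inverseˡ; inverseʳ)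
open import Data.Fin.Properties using (toℕ<n; toℕ-injective; toℕ-inject₁; pigeonhole; fromℕ<-injective)
open import Data.List
  using (List; []; _∷_; _++_; length; map; filterᵇ; allFin; tabulate; lookup; foldl; concatMap;
         reverse; upTo; downFrom)
open import Data.List.Properties
  using (length-++; length-map; filter-++; filter-accept; filter-reject; filter-none; filter-some;
         map-tabulate; map-upTo; reverse-map; reverse-upTo; ∷-injective)
open import Data.List.Membership.Propositional using (_∈_; lose)
open import Data.List.Membership.Propositional.Properties
  using (∈-filter⁺; ∈-filter⁻; ∈-lookup; ∈-++⁻; ∈-map⁻)
open import Data.List.Relation.Unary.Any using (here; there)
open import Data.List.Relation.Unary.All as All using (All; []; _∷_)
open import Data.List.Relation.Unary.All.Properties using (all-filter)
import Data.List.Relation.Unary.All.Properties as Allₚ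
open import Data.List.Relation.Unary.AllPairs using (AllPairs; []; _∷_)
import Data.List.Relation.Unary.AllPairs.Properties as AllPairs
open import Data.List.Relation.Binary.Permutation.Propositional
  using (_↭_; ↭-refl; ↭-sym; ↭-trans; prep; swap)
open import Data.List.Relation.Binary.Permutation.Propositional.Properties
  using (↭-length; filter-↭; ∈-resp-↭; All-resp-↭)
open import Data.Maybe using (Maybe; nothing; just)
open import Data.Nat using (ℕ; zero; suc; _+_; _∸_; _≤_; _<_; _≤ᵇ_; _<ᵇ_; _≡ᵇ_; z≤n; s≤s; z<s)
open import Data.Nat.Properties
open import Data.Product using (_×_; _,_; proj₁; proj₂)
import Data.Product
open import Data.Product.Function.NonDependent.Propositional using (_×-⇔_)
open import Data.Sum using (_⊎_; inj₁; inj₂)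
import Data.Sum
open import Data.Sum.Function.Propositional using (_⊎-⇔_)
open import Data.Unit using (⊤; tt)
open import Function using (_∘_; id)
open import Function.Bundles using (_⇔_; mk⇔; Equivalence)
open import Function.Properties.Equivalence using () renaming (sym to ⇔-sym; trans to ⇔-trans)
open import Relation.Binary using (tri<; tri≈; tri>)
open import Relation.Binary.PropositionalEquality
  using (_≡_; _≢_; refl; sym; trans; cong; cong₂; subst; subst₂; module ≡-Reasoning)
open import Relation.Nullary using (¬_; yes; no)
open import Relation.Nullary.Decidable using (T?)

open Equivalence using (to; from)

T-not : ∀ {b} → T (not b) ⇔ (¬ T b)
T-not {true}  = mk⇔ (λ ()) (λ ¬t → ¬t tt)
T-not {false} = mk⇔ (λ _ ()) (λ _ → tt)

T-<ᵇ : ∀ {m n} → T (m <ᵇ n) ⇔ m < n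
T-<ᵇ = mk⇔ (<ᵇ⇒< _ _) <⇒<ᵇ

T-≤ᵇ : ∀ {m n} → T (m ≤ᵇ n) ⇔ m ≤ n
T-≤ᵇ = mk⇔ (≤ᵇ⇒≤ _ _) ≤⇒≤ᵇ

T-≡ᵇ : ∀ {m n} → T (m ≡ᵇ n) ⇔ m ≡ n
T-≡ᵇ = mk⇔ (≡ᵇ⇒≡ _ _) (≡⇒≡ᵇ _ _)

T-not-<ᵇ : ∀ {m n} → T (not (m <ᵇ n)) ⇔ n ≤ m
T-not-<ᵇ = mk⇔ (λ t → ≮⇒≥ (to T-not t ∘ from T-<ᵇ))
               (λ n≤m → from T-not (≤⇒≯ n≤m ∘ to T-<ᵇ))

module _ {A : Set} where

  count-∷-accept : ∀ (p : A → Bool) {x} xs → T (p x) → count p (x ∷ xs) ≡ suc (count p xs)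
  count-∷-accept p xs px = cong length (filter-accept (T? ∘ p) px)

  count-∷-reject : ∀ (p : A → Bool) {x} xs → ¬ T (p x) → count p (x ∷ xs) ≡ count p xs
  count-∷-reject p xs ¬px = cong length (filter-reject (T? ∘ p) ¬px)

  count-++ : ∀ (p : A → Bool) xs ys → count p (xs ++ ys) ≡ count p xs + count p ys
  count-++ p xs ys = trans (cong length (filter-++ (T? ∘ p) xs ys)) (length-++ (filterᵇ p xs))

  count-↭ : ∀ (p : A → Bool) {xs ys} → xs ↭ ys → count p xs ≡ count p ys
  count-↭ p xs↭ys = ↭-length (filter-↭ (T? ∘ p) xs↭ys)

  count-none : ∀ (p : A → Bool) xs → (∀ {x} → x ∈ xs → ¬ T (p x)) → count p xs ≡ 0
  count-none p xs none = cong length (filter-none (T? ∘ p) (All.tabulate none))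

  count-some : ∀ (p : A → Bool) {x xs} → x ∈ xs → T (p x) → 0 < count p xs
  count-some p x∈xs px = filter-some (T? ∘ p) (lose x∈xs px)

  count-mono : ∀ (p q : A → Bool) xs → (∀ {x} → x ∈ xs → T (p x) → T (q x)) →
               count p xs ≤ count q xs
  count-mono p q [] _ = z≤n
  count-mono p q (x ∷ xs) p⇒q with ih ← count-mono p q xs (p⇒q ∘ there) | p x in px | q x in qx
  ... | true  | true  = s≤s ih
  ... | true  | false = ⊥-elim (subst T qx (p⇒q (here refl) (subst T (sym px) tt)))
  ... | false | true  = m≤n⇒m≤1+n ih
  ... | false | false = ih

  count-cong : ∀ (p q : A → Bool) xs → (∀ {x} → x ∈ xs → T (p x) ⇔ T (q x)) →
               count p xs ≡ count q xs
  count-cong p q xs p⇔q =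
    ≤-antisym (count-mono p q xs (to ∘ p⇔q)) (count-mono q p xs (from ∘ p⇔q))

  count-split : ∀ (p q : A → Bool) xs →
                count p xs ≡ count (λ x → p x ∧ q x) xs + count (λ x → p x ∧ not (q x)) xs
  count-split p q [] = refl
  count-split p q (x ∷ xs) with ih ← count-split p q xs | p x | q x
  ... | true  | true  = cong suc ih
  ... | true  | false = trans (cong suc ih) (sym (+-suc _ _))
  ... | false | _     = ih

  count-filter : ∀ (p q : A → Bool) xs → count p (filterᵇ q xs) ≡ count (λ x → p x ∧ q x) xs
  count-filter p q [] = refl
  count-filter p q (x ∷ xs) with ih ← count-filter p q xs | q x
  ... | true with p x
  ...   | true  = cong suc ih
  ...   | false = ih
  count-filter p q (x ∷ xs) | false with p x
  ...   | true  = ih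
  ...   | false = ih

  count-partition : ∀ (p q : A → Bool) xs →
                    count p xs ≡ count p (filterᵇ q xs) + count p (filterᵇ (λ x → not (q x)) xs)
  count-partition p q xs = trans (count-split p q xs)
    (sym (cong₂ _+_ (count-filter p q xs) (count-filter p (λ x → not (q x)) xs)))

  count-map : ∀ {B : Set} (p : B → Bool) (f : A → B) xs → count p (map f xs) ≡ count (p ∘ f) xs
  count-map p f [] = refl
  count-map p f (x ∷ xs) with ih ← count-map p f xs | p (f x)
  ... | true  = cong suc ih
  ... | false = ih

  ∈-length≤1 : ∀ {xs : List A} {x y} → length xs ≤ 1 → x ∈ xs → y ∈ xs → x ≡ y
  ∈-length≤1 {_ ∷ []}    _        (here refl) (here refl) = refl
  ∈-length≤1 {_ ∷ _ ∷ _} (s≤s ()) _           _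

  count≤1-unique : ∀ (p : A → Bool) {xs x y} → count p xs ≤ 1 →
                   x ∈ xs → y ∈ xs → T (p x) → T (p y) → x ≡ y
  count≤1-unique p c x∈xs y∈xs px py =
    ∈-length≤1 c (∈-filter⁺ (T? ∘ p) x∈xs px) (∈-filter⁺ (T? ∘ p) y∈xs py)

  anyᵇ-false : ∀ (p : A → Bool) xs → anyᵇ p xs ≡ false → All (λ x → ¬ T (p x)) xs
  anyᵇ-false p [] _ = []
  anyᵇ-false p (x ∷ xs) none with p x in px
  ... | false = subst T px ∷ anyᵇ-false p xs none

  AllPairs-zipAll : ∀ {P : A → Set} {R S : A → A → Set} {xs} →
                    (∀ {x y} → P x → P y → R x y → S x y) → All P xs → AllPairs R xs → AllPairs S xs
  AllPairs-zipAll f []         []         = []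
  AllPairs-zipAll f (px ∷ pxs) (rx ∷ rxs) =
    All.zipWith (λ (py , r) → f px py r) (pxs , rx) ∷ AllPairs-zipAll f pxs rxs

  AllPairs-lookup : ∀ {R : A → A → Set} {xs} → AllPairs R xs →
                    ∀ {i j} → i Fin.< j → R (lookup xs i) (lookup xs j)
  AllPairs-lookup (Rx ∷ _)   {fzero}  {fsuc j} _         = All.lookup Rx (∈-lookup j)
  AllPairs-lookup (_  ∷ Rxs) {fsuc i} {fsuc j} (s≤s i<j) = AllPairs-lookup Rxs i<j

  HeadFirst : (A → Bool) → List A → Set
  HeadFirst q []       = ⊤
  HeadFirst q (x ∷ xs) = ∀ {y} → y ∈ xs → T (q y) → T (q x)

distinct-bounded⇒length≤ : ∀ {N} {xs : List ℕ} → AllPairs _≢_ xs → All (_< N) xs → length xs ≤ N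
distinct-bounded⇒length≤ distinct bounded = ≮⇒≥ λ N<len →
  let (i , j , i<j , same) = pigeonhole N<len (λ k → fromℕ< (All.lookup bounded (∈-lookup k)))
  in AllPairs-lookup distinct i<j (fromℕ<-injective _ _ _ _ same)

count-allFin-< : ∀ n y → y ≤ n → count (λ (k : Fin n) → toℕ k <ᵇ y) (allFin n) ≡ y
count-allFin-< n       zero    _         = count-none _ (allFin n) (λ _ ())
count-allFin-< (suc n) (suc y) (s≤s y≤n) = cong suc (begin
  count p (tabulate fsuc)          ≡⟨ cong (count p) (map-tabulate id fsuc) ⟨
  count p (map fsuc (allFin n))    ≡⟨ count-map p fsuc (allFin n) ⟩
  count (p ∘ fsuc) (allFin n)      ≡⟨ count-allFin-< n y y≤n ⟩
  y                                ∎)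
  where
  open ≡-Reasoning
  p : Fin (suc n) → Bool
  p k = toℕ k <ᵇ suc y

count-allFin-interval : ∀ n {a i} → a ≤ i → i ≤ n →
                        count (λ (k : Fin n) → (toℕ k <ᵇ i) ∧ not (toℕ k <ᵇ a)) (allFin n) ≡ i ∸ a
count-allFin-interval n {a} {i} a≤i i≤n = sym (begin
  i ∸ a                                   ≡⟨ cong (_∸ a) (count-allFin-< n i i≤n) ⟨
  count below-i (allFin n) ∸ a            ≡⟨ cong (_∸ a) (count-split below-i below-a (allFin n)) ⟩
  count (λ k → below-i k ∧ below-a k) (allFin n) + between ∸ a
    ≡⟨ cong (λ m → m + between ∸ a) (count-cong _ _ (allFin n) (λ _ → below-a-only)) ⟩
  count below-a (allFin n) + between ∸ a
    ≡⟨ cong (λ m → m + between ∸ a) (count-allFin-< n a (≤-trans a≤i i≤n)) ⟩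
  a + between ∸ a                         ≡⟨ m+n∸m≡n a between ⟩
  between                                 ∎)
  where
  open ≡-Reasoning
  below-i below-a : Fin n → Bool
  below-i k = toℕ k <ᵇ i
  below-a k = toℕ k <ᵇ a
  between : ℕ
  between = count (λ k → below-i k ∧ not (below-a k)) (allFin n)
  below-a-only : ∀ {k} → T (below-i k ∧ below-a k) ⇔ T (below-a k)
  below-a-only =
    mk⇔ (proj₂ ∘ to T-∧) (λ k<a → from T-∧ (from T-<ᵇ (<-≤-trans (to T-<ᵇ k<a) a≤i) , k<a))

≤-pred-∸ : ∀ {m} k a → suc m ≤ suc k ∸ a → m ≤ k ∸ a
≤-pred-∸ k a h = ≤-trans (pred-mono-≤ h) (≤-reflexive (pred[m∸n]≡m∸[1+n] (suc k) a))

toℕ-pred : ∀ {n} {x : Fin n} {r} → toℕ x ≡ suc r → toℕ (pred x) ≡ r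
toℕ-pred {x = fsuc x} eq = trans (toℕ-inject₁ x) (suc-injective eq)

map-toℕ-reverse-allFin : ∀ n → map toℕ (reverse (allFin n)) ≡ downFrom n
map-toℕ-reverse-allFin n = begin
  map toℕ (reverse (allFin n)) ≡⟨ reverse-map toℕ (allFin n) ⟩
  reverse (map toℕ (allFin n)) ≡⟨ cong reverse (trans (map-tabulate id toℕ) (tabulate-toℕ n)) ⟩
  reverse (upTo n)             ≡⟨ reverse-upTo n ⟩
  downFrom n                   ∎
  where
  open ≡-Reasoning
  tabulate-toℕ : ∀ n → tabulate {n = n} toℕ ≡ upTo n
  tabulate-toℕ zero    = refl
  tabulate-toℕ (suc n) = cong (0 ∷_) (begin
    tabulate (suc ∘ toℕ)     ≡⟨ map-tabulate toℕ suc ⟨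
    map suc (tabulate toℕ)   ≡⟨ cong (map suc) (tabulate-toℕ n) ⟩
    map suc (upTo n)         ≡⟨ map-upTo suc n ⟩
    _                        ∎)

module _ {n : ℕ} (w : Permutation′ n) where

  w[_] w⁻¹[_] : Fin n → ℕ
  w[ i ]   = toℕ (w ⟨$⟩ʳ i)
  w⁻¹[ j ] = toℕ (w ⟨$⟩ˡ j)

  w[w⁻¹] : ∀ {j} → w[ w ⟨$⟩ˡ j ] ≡ toℕ j
  w[w⁻¹] = cong toℕ (inverseʳ w)

  T-inD : ∀ {i j} → T (inDᵇ w (i , j)) ⇔ (toℕ i < w⁻¹[ j ] × toℕ j < w[ i ])
  T-inD = ⇔-trans T-∧ (T-<ᵇ ×-⇔ T-<ᵇ)

  not-inD-right-of-graph : ∀ {i k} → toℕ k < toℕ i → ¬ T (inDᵇ w (i , w ⟨$⟩ʳ k))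
  not-inD-right-of-graph {i} {k} k<i d =
    <-asym k<i (subst (λ z → toℕ i < toℕ z) (inverseˡ w) (proj₁ (to T-inD d)))

  insertR-↭ : ∀ x ys → insertR w x ys ↭ x ∷ ys
  insertR-↭ x []       = ↭-refl
  insertR-↭ x (y ∷ ys) with precR w x y
  ... | true  = ↭-refl
  ... | false = ↭-trans (prep y (insertR-↭ x ys)) (swap y x ↭-refl)

  sortR-↭ : ∀ xs → sortR w xs ↭ xs
  sortR-↭ []       = ↭-refl
  sortR-↭ (x ∷ xs) = ↭-trans (insertR-↭ x (sortR w xs)) (prep x (sortR-↭ xs))

  module _ (q : Square n → Bool) (U : Square n → Set)
           (q-first : ∀ {y z} → U y → U z → T (q y) → ¬ T (q z) →
                      T (precR w y z) × ¬ T (precR w z y)) where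

    insertR-headFirst : ∀ {x} ys → U x → All U ys → HeadFirst q ys → HeadFirst q (insertR w x ys)
    insertR-headFirst []       _  _          _  ()
    insertR-headFirst {x} (y ∷ ys) Ux (Uy ∷ Uys) hf with precR w x y in x≺y
    ... | true  = x-first
      where
      qy : ∀ {z} → z ∈ y ∷ ys → T (q z) → T (q y)
      qy (here refl) qz = qz
      qy (there z∈)  qz = hf z∈ qz
      x-first : HeadFirst q (x ∷ y ∷ ys)
      x-first z∈ qz with T? (q x)
      ... | yes qx = qx
      ... | no ¬qx = ⊥-elim (proj₂ (q-first Uy Ux (qy z∈ qz) ¬qx) (subst T (sym x≺y) tt))
    ... | false = y-first
      where
      y-first : HeadFirst q (y ∷ insertR w x ys)
      y-first z∈ qz with T? (q y)
      ... | yes qy = qy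
      ... | no ¬qy with ∈-resp-↭ (insertR-↭ x ys) z∈
      ...   | here refl  = ⊥-elim (subst T x≺y (proj₁ (q-first Ux Uy qz ¬qy)))
      ...   | there z∈ys = ⊥-elim (¬qy (hf z∈ys qz))

    sortR-headFirst : ∀ {xs} → All U xs → HeadFirst q (sortR w xs)
    sortR-headFirst []                  = tt
    sortR-headFirst {x ∷ xs} (Ux ∷ Uxs) =
      insertR-headFirst (sortR w xs) Ux (All-resp-↭ (↭-sym (sortR-↭ xs)) Uxs) (sortR-headFirst Uxs)

  -- Coranks and the scan A_R

  coRankᵇ : Square n → Fin n → Bool
  coRankᵇ (i , j) k = (k <F i) ∧ not ((w ⟨$⟩ʳ k) <F j)

  T-coRankᵇ : ∀ {i j k} → T (coRankᵇ (i , j) k) ⇔ (toℕ k < toℕ i × toℕ j ≤ w[ k ])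
  T-coRankᵇ = ⇔-trans T-∧ (T-<ᵇ ×-⇔ T-not-<ᵇ)

  coRank : Square n → ℕ
  coRank s = count (coRankᵇ s) (allFin n)

  rank+coRank : ∀ i j → rank w (i , j) + coRank (i , j) ≡ toℕ i
  rank+coRank i j = trans (sym (count-split (_<F i) (λ k → (w ⟨$⟩ʳ k) <F j) (allFin n)))
                          (count-allFin-< n (toℕ i) (<⇒≤ (toℕ<n i)))

  coRank≡⇒linked : ∀ s t → coRank s ≡ coRank t → T (linkedᵇ w s t)
  coRank≡⇒linked (i , j) (i′ , j′) same = from T-≡ᵇ (begin
    toℕ i + r′                   ≡⟨ cong (_+ r′) (rank+coRank i j) ⟨
    r + coRank (i , j) + r′      ≡⟨ cong (λ c → r + c + r′) same ⟩
    r + coRank (i′ , j′) + r′    ≡⟨ +-assoc r _ r′ ⟩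
    r + (coRank (i′ , j′) + r′)  ≡⟨ cong (r +_) (trans (+-comm _ r′) (rank+coRank i′ j′)) ⟩
    r + toℕ i′                   ≡⟨ +-comm r (toℕ i′) ⟩
    toℕ i′ + r                   ∎)
    where
    open ≡-Reasoning
    r r′ : ℕ
    r  = rank w (i , j)
    r′ = rank w (i′ , j′)

  Unlinked : List (Square n) → Set
  Unlinked xs = All (T ∘ inDᵇ w) xs × AllPairs (λ s t → coRank s ≢ coRank t) xs

  -- Definitionally the step function of the fold defining A-R.
  scanStep : List (Square n) → Square n → List (Square n)
  scanStep acc s =
    if anyᵇ (λ t → (proj₂ t =F proj₂ s) ∨ linkedᵇ w t s) acc then acc else acc ++ s ∷ []

  scanStep-unlinked : ∀ {acc s} → T (inDᵇ w s) → Unlinked acc → Unlinked (scanStep acc s)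
  scanStep-unlinked {acc} {s} s∈D (acc⊆D , distinct)
    with anyᵇ (λ t → (proj₂ t =F proj₂ s) ∨ linkedᵇ w t s) acc in clash
  ... | true  = acc⊆D , distinct
  ... | false = Allₚ.++⁺ acc⊆D (s∈D ∷ []) ,
                AllPairs.++⁺ distinct ([] ∷ [])
                  (All.map (λ {t} ¬clash → unlinked {t} ¬clash ∷ []) (anyᵇ-false _ acc clash))
    where
    unlinked : ∀ {t} → ¬ T ((proj₂ t =F proj₂ s) ∨ linkedᵇ w t s) → coRank t ≢ coRank s
    unlinked {t} ¬clash same = ¬clash (from T-∨ (inj₂ (coRank≡⇒linked t s same)))

  sortedD⊆D : All (T ∘ inDᵇ w) (sortR w (D w))
  sortedD⊆D = All-resp-↭ (↭-sym (sortR-↭ (D w)))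
    (all-filter (T? ∘ inDᵇ w) (concatMap (λ i → map (i ,_) (allFin n)) (allFin n)))

  A-R-unlinked : Unlinked (A-R w)
  A-R-unlinked = scan sortedD⊆D ([] , [])
    where
    scan : ∀ {acc xs} → All (T ∘ inDᵇ w) xs → Unlinked acc → Unlinked (foldl scanStep acc xs)
    scan []            u = u
    scan (s∈D ∷ xs⊆D) u = scan xs⊆D (scanStep-unlinked s∈D u)

  -- Corners, quadrants and blocks

  -- A corner is either nothing, whose quadrant is the whole grid, or a graph point (p, w(p)),
  -- whose quadrant consists of the squares strictly south-east of it.
  rowFrom colFrom : Maybe (Fin n) → ℕ
  rowFrom nothing  = 0
  rowFrom (just p) = suc (toℕ p)
  colFrom nothing  = 0
  colFrom (just p) = suc w[ p ]

  Quadrant : Maybe (Fin n) → Square n → Set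
  Quadrant c (i , j) = rowFrom c ≤ toℕ i × colFrom c ≤ toℕ j

  quadrantᵇ : Maybe (Fin n) → Square n → Bool
  quadrantᵇ c (i , j) = (rowFrom c ≤ᵇ toℕ i) ∧ (colFrom c ≤ᵇ toℕ j)

  T-quadrant : ∀ {c i j} → T (quadrantᵇ c (i , j)) ⇔ Quadrant c (i , j)
  T-quadrant = ⇔-trans T-∧ (T-≤ᵇ ×-⇔ T-≤ᵇ)

  blockᵇ : Maybe (Fin n) → ℕ → Square n → Bool
  blockᵇ c b s = (toℕ (proj₁ s) ≤ᵇ b) ∧ quadrantᵇ c s

  T-block : ∀ {c b i j} → T (blockᵇ c b (i , j)) ⇔ (toℕ i ≤ b × Quadrant c (i , j))
  T-block = ⇔-trans T-∧ (T-≤ᵇ ×-⇔ T-quadrant)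

  block⇒quadrant : ∀ {c b s} → T (blockᵇ c b s) → T (quadrantᵇ c s)
  block⇒quadrant {c} {b} {i , j} = proj₂ ∘ to (T-∧ {toℕ i ≤ᵇ b})

  quadrant⇒block : ∀ {c b i j} → toℕ i ≤ b → T (quadrantᵇ c (i , j)) → T (blockᵇ c b (i , j))
  quadrant⇒block {c} {b} {i} i≤b q = from (T-∧ {toℕ i ≤ᵇ b}) (from T-≤ᵇ i≤b , q)

  block-rows : ∀ {c b b′ i j} → (toℕ i ≤ b → toℕ i ≤ b′) →
               T (blockᵇ c b (i , j)) → T (blockᵇ c b′ (i , j))
  block-rows {c} {b} {b′} {i} {j} f t =
    let (i≤b , q) = to (T-∧ {toℕ i ≤ᵇ b}) t in quadrant⇒block {c} {b′} {i} {j} (f (to T-≤ᵇ i≤b)) q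

  cornerRank : Maybe (Fin n) → ℕ
  cornerRank nothing  = 0
  cornerRank (just p) = count (λ k → (k <F p) ∧ ((w ⟨$⟩ʳ p) <F (w ⟨$⟩ʳ k))) (allFin n)

  coRankFrom : Maybe (Fin n) → Square n → ℕ
  coRankFrom c s = count (λ k → coRankᵇ s k ∧ (rowFrom c ≤ᵇ toℕ k)) (allFin n)

  T-coRankFromᵇ : ∀ {c i j k} → T (coRankᵇ (i , j) k ∧ (rowFrom c ≤ᵇ toℕ k)) ⇔
                  ((toℕ k < toℕ i × toℕ j ≤ w[ k ]) × rowFrom c ≤ toℕ k)
  T-coRankFromᵇ = ⇔-trans T-∧ (T-coRankᵇ ×-⇔ T-≤ᵇ)

  coRankFrom-< : ∀ c {b i j} → rowFrom c ≤ toℕ i → toℕ i ≤ b →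
                 coRankFrom c (i , j) < suc b ∸ rowFrom c
  coRankFrom-< c {b} {i} {j} a≤i i≤b = begin-strict
    coRankFrom c (i , j)     ≤⟨ count-mono _ _ (allFin n) (λ _ → between) ⟩
    count (λ k → (toℕ k <ᵇ toℕ i) ∧ not (toℕ k <ᵇ rowFrom c)) (allFin n)
                             ≡⟨ count-allFin-interval n a≤i (<⇒≤ (toℕ<n i)) ⟩
    toℕ i ∸ rowFrom c        <⟨ s≤s (∸-monoˡ-≤ (rowFrom c) i≤b) ⟩
    suc (b ∸ rowFrom c)      ≡⟨ +-∸-assoc 1 (≤-trans a≤i i≤b) ⟨
    suc b ∸ rowFrom c        ∎
    where
    open ≤-Reasoning
    between : ∀ {k} → T (coRankᵇ (i , j) k ∧ (rowFrom c ≤ᵇ toℕ k)) →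
              T ((toℕ k <ᵇ toℕ i) ∧ not (toℕ k <ᵇ rowFrom c))
    between {k} t = let ((k<i , _) , a≤k) = to (T-coRankFromᵇ {c} {i} {j} {k}) t
                    in from (T-∧ {toℕ k <ᵇ toℕ i}) (from T-<ᵇ k<i , from T-not-<ᵇ a≤k)

  left-of-corner : ∀ {p x j} → toℕ p < toℕ x → T (inDᵇ w (x , j)) → ¬ Quadrant (just p) (x , j) →
                   toℕ j < w[ p ]
  left-of-corner {p} {x} {j} p<x d ¬q = ≤∧≢⇒< (≮⇒≥ (λ wp<j → ¬q (p<x , wp<j))) off-graph
    where
    off-graph : toℕ j ≢ w[ p ]
    off-graph j≡wp =
      not-inD-right-of-graph p<x (subst (λ z → T (inDᵇ w (x , z))) (toℕ-injective j≡wp) d)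

  up : Square n → Square n
  up s = (pred (proj₁ s) , proj₂ s)

  up-inD : ∀ {x r j} → toℕ x ≡ suc r → T (inDᵇ w (x , j)) → ¬ Quadrant (just (pred x)) (x , j) →
           T (inDᵇ w (up (x , j)))
  up-inD {x} x≡ d ¬q = from T-inD (<-trans p<x (proj₁ (to T-inD d)) , left-of-corner p<x d ¬q)
    where
    p<x : toℕ (pred x) < toℕ x
    p<x = subst₂ _<_ (sym (toℕ-pred x≡)) (sym x≡) (n<1+n _)

  T-precR-sameRow : ∀ {x j j′} → T (precR w (x , j) (x , j′)) ⇔
    (bcount w (x , j) < bcount w (x , j′) ⊎ (bcount w (x , j) ≡ bcount w (x , j′) × toℕ j′ < toℕ j))
  T-precR-sameRow {x} {j} {j′} = mk⇔ forth back
    where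
    b b′ : ℕ
    b  = bcount w (x , j)
    b′ = bcount w (x , j′)
    later⇔ : T ((b <ᵇ b′) ∨ ((b ≡ᵇ b′) ∧ (j′ <F j))) ⇔ (b < b′ ⊎ (b ≡ b′ × toℕ j′ < toℕ j))
    later⇔ = ⇔-trans (T-∨ {b <ᵇ b′}) (T-<ᵇ ⊎-⇔ ⇔-trans (T-∧ {b ≡ᵇ b′}) (T-≡ᵇ ×-⇔ T-<ᵇ))
    forth : T (precR w (x , j) (x , j′)) → b < b′ ⊎ (b ≡ b′ × toℕ j′ < toℕ j)
    forth t with to (T-∨ {x <F x}) t
    ... | inj₁ x<x = ⊥-elim (<-irrefl refl (to (T-<ᵇ {toℕ x}) x<x))
    ... | inj₂ t′  = to later⇔ (proj₂ (to (T-∧ {x =F x}) t′))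
    back : b < b′ ⊎ (b ≡ b′ × toℕ j′ < toℕ j) → T (precR w (x , j) (x , j′))
    back later =
      from (T-∨ {x <F x}) (inj₂ (from (T-∧ {x =F x}) (from (T-≡ᵇ {toℕ x}) refl , from later⇔ later)))

  precR-sameRow : ∀ {x j j′} → bcount w (x , j) ≤ bcount w (x , j′) → toℕ j′ < toℕ j →
                  T (precR w (x , j) (x , j′)) × ¬ T (precR w (x , j′) (x , j))
  precR-sameRow {x} {j} {j′} b≤b′ j′<j = from T-precR-sameRow earlier , not-later ∘ to T-precR-sameRow
    where
    earlier : bcount w (x , j) < bcount w (x , j′) ⊎
              (bcount w (x , j) ≡ bcount w (x , j′) × toℕ j′ < toℕ j)
    earlier = Data.Sum.map₂ (_, j′<j) (m≤n⇒m<n∨m≡n b≤b′)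
    not-later : ¬ (bcount w (x , j′) < bcount w (x , j) ⊎
                   (bcount w (x , j′) ≡ bcount w (x , j) × toℕ j < toℕ j′))
    not-later (inj₁ b′<b)       = <⇒≱ b′<b b≤b′
    not-later (inj₂ (_ , j<j′)) = <-asym j<j′ j′<j

  onRow : Fin n → Square n → Bool
  onRow x s = proj₁ s =F x

  T-onRow : ∀ {x s} → T (onRow x s) ⇔ (proj₁ s ≡ x)
  T-onRow = mk⇔ (toℕ-injective ∘ to T-≡ᵇ) (from T-≡ᵇ ∘ cong toℕ)

  -- Rows r + 1, …, n − 1 have been processed and hold at most one square each.  For b ≤ r, the
  -- quadrant of any corner meets rows ≤ b in at most as many squares as it has rows there.
  record RowInvariant (r : ℕ) (L : List (Square n)) : Set where
    field
      inDiagram  : ∀ {s} → s ∈ L → T (inDᵇ w s)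
      rowUnique  : ∀ {s t} → s ∈ L → t ∈ L → proj₁ s ≡ proj₁ t → r < toℕ (proj₁ s) → s ≡ t
      blockBound : ∀ c b → b ≤ r → count (blockᵇ c b) L ≤ suc b ∸ rowFrom c

  RowInvariant-0⇒rowUnique : ∀ {L} → RowInvariant 0 L →
                             ∀ {s t} → s ∈ L → t ∈ L → proj₁ s ≡ proj₁ t → s ≡ t
  RowInvariant-0⇒rowUnique inv {s} {t} s∈ t∈ same with toℕ (proj₁ s) in row
  ... | suc _ = RowInvariant.rowUnique inv s∈ t∈ same (subst (0 <_) (sym row) z<s)
  ... | zero  = count≤1-unique (blockᵇ nothing 0) (RowInvariant.blockBound inv nothing 0 z≤n) s∈ t∈
                  (in-row-0 {s} row) (in-row-0 {t} (trans (cong toℕ (sym same)) row))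
    where
    in-row-0 : ∀ {u} → toℕ (proj₁ u) ≡ 0 → T (blockᵇ nothing 0 u)
    in-row-0 {i , j} row = quadrant⇒block {nothing} {0} {i} {j} (≤-reflexive row) tt

  -- Vexillarity

  module _ (vex : Vexillary w) where

    no-2143 : ∀ {a b c j} → toℕ a < toℕ b → toℕ b < toℕ c → toℕ c < w⁻¹[ j ] →
              w[ b ] < w[ a ] → w[ a ] < toℕ j → toℕ j < w[ c ] → ⊥
    no-2143 {a} {b} {c} a<b b<c c<d wb<wa wa<j j<wc = vex _ _ _ _ a<b b<c c<d wb<wa
      (subst (w[ a ] <_) (sym w[w⁻¹]) wa<j) (subst (_< w[ c ]) (sym w[w⁻¹]) j<wc)

    coRank-before-corner : ∀ {p i j k} → toℕ p < toℕ i → w[ p ] < toℕ j → T (inDᵇ w (i , j)) →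
      ((toℕ k < toℕ i × toℕ j ≤ w[ k ]) × toℕ k ≤ toℕ p) ⇔ (toℕ k < toℕ p × w[ p ] < w[ k ])
    coRank-before-corner {p} {i} {j} {k} p<i wp<j d = mk⇔ forth back
      where
      forth : (toℕ k < toℕ i × toℕ j ≤ w[ k ]) × toℕ k ≤ toℕ p → toℕ k < toℕ p × w[ p ] < w[ k ]
      forth ((_ , j≤wk) , k≤p) =
        ≤∧≢⇒< k≤p (λ k≡p → <-irrefl (cong w[_] (sym (toℕ-injective k≡p))) wp<wk) , wp<wk
        where
        wp<wk = <-≤-trans wp<j j≤wk
      back : toℕ k < toℕ p × w[ p ] < w[ k ] → (toℕ k < toℕ i × toℕ j ≤ w[ k ]) × toℕ k ≤ toℕ p
      back (k<p , wp<wk) =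
        (<-trans k<p p<i , ≮⇒≥ (λ wk<j → no-2143 k<p p<i i<w⁻¹j wp<wk wk<j j<wi)) , <⇒≤ k<p
        where
        i<w⁻¹j = proj₁ (to T-inD d)
        j<wi   = proj₂ (to T-inD d)

    coRank-split : ∀ c {i j} → T (inDᵇ w (i , j)) → Quadrant c (i , j) →
                   coRank (i , j) ≡ coRankFrom c (i , j) + cornerRank c
    coRank-split c {i} {j} d q =
      trans (count-split (coRankᵇ (i , j)) (λ k → rowFrom c ≤ᵇ toℕ k) (allFin n))
            (cong (coRankFrom c (i , j) +_) (outside c q))
      where
      outside : ∀ c → Quadrant c (i , j) →
                count (λ k → coRankᵇ (i , j) k ∧ not (rowFrom c ≤ᵇ toℕ k)) (allFin n) ≡ cornerRank c
      outside nothing  _             = count-none _ (allFin n) (λ _ t → proj₂ (to T-∧ t))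
      outside (just p) (p<i , wp<j) = count-cong _ _ (allFin n) λ _ →
        ⇔-trans (⇔-trans T-∧ (T-coRankᵇ ×-⇔ T-not-<ᵇ))
                (⇔-trans (coRank-before-corner p<i wp<j d) (⇔-sym (⇔-trans T-∧ (T-<ᵇ ×-⇔ T-<ᵇ))))

    bcount-mono : ∀ {p x j j′} → toℕ p < toℕ x → toℕ j′ < w[ p ] → w[ p ] < toℕ j →
                  T (inDᵇ w (x , j′)) → bcount w (x , j) ≤ bcount w (x , j′)
    bcount-mono {p} {x} {j} {j′} p<x j′<wp wp<j d′ = count-mono _ _ (allFin n) λ {i} _ t →
      let (x<i , d) = to (T-∧ {x <F i}) t
      in from (T-∧ {x <F i}) (x<i , column-shift (to T-inD d))
      where
      column-shift : ∀ {i} → toℕ i < w⁻¹[ j ] × toℕ j < w[ i ] → T (inDᵇ w (i , j′))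
      column-shift {i} (i<w⁻¹j , j<wi) = from T-inD (i<w⁻¹j′ , j′<wi)
        where
        j′<wi = <-trans j′<wp (<-trans wp<j j<wi)
        i<w⁻¹j′ : toℕ i < w⁻¹[ j′ ]
        i<w⁻¹j′ with <-cmp (toℕ i) w⁻¹[ j′ ]
        ... | tri< i<d _ _ = i<d
        ... | tri≈ _ i≡d _ =
          ⊥-elim (<-irrefl (sym (trans (cong w[_] (toℕ-injective i≡d)) w[w⁻¹])) j′<wi)
        ... | tri> _ _ d<i = ⊥-elim (no-2143 (<-trans p<x (proj₁ (to T-inD d′))) d<i i<w⁻¹j
                                             (subst (_< w[ p ]) (sym w[w⁻¹]) j′<wp) wp<j j<wi)

    quadrant-first : ∀ c {x j j′} → T (inDᵇ w (x , j)) → T (inDᵇ w (x , j′)) →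
                     Quadrant c (x , j) → ¬ Quadrant c (x , j′) →
                     T (precR w (x , j) (x , j′)) × ¬ T (precR w (x , j′) (x , j))
    quadrant-first nothing  _ _  _            ¬q′ = ⊥-elim (¬q′ (z≤n , z≤n))
    quadrant-first (just p) _ d′ (p<x , wp<j) ¬q′ =
      precR-sameRow (bcount-mono p<x j′<wp wp<j d′) (<-trans j′<wp wp<j)
      where
      j′<wp = left-of-corner p<x d′ ¬q′

    A-R-blockBound : ∀ c b → count (blockᵇ c b) (A-R w) ≤ suc b ∸ rowFrom c
    A-R-blockBound c b = subst (_≤ suc b ∸ rowFrom c) (length-map (coRankFrom c) S)
      (distinct-bounded⇒length≤
        (AllPairs.map⁺ (AllPairs-zipAll distinct inS
          (AllPairs.filter⁺ (T? ∘ blockᵇ c b) (proj₂ A-R-unlinked))))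
        (Allₚ.map⁺ (All.map bounded inS)))
      where
      S : List (Square n)
      S = filterᵇ (blockᵇ c b) (A-R w)
      InBlock : Square n → Set
      InBlock s = T (inDᵇ w s) × T (blockᵇ c b s)
      inS : All InBlock S
      inS = All.tabulate λ s∈S →
        let (s∈A , blk) = ∈-filter⁻ (T? ∘ blockᵇ c b) {xs = A-R w} s∈S
        in All.lookup (proj₁ A-R-unlinked) s∈A , blk
      distinct : ∀ {s t} → InBlock s → InBlock t → coRank s ≢ coRank t → coRankFrom c s ≢ coRankFrom c t
      distinct {i , j} {i′ , j′} (d , blk) (d′ , blk′) ≢ same = ≢ (begin
        coRank (i , j)                        ≡⟨ coRank-split c d (proj₂ (to (T-block {c} {b} {i} {j}) blk)) ⟩
        coRankFrom c (i , j) + cornerRank c   ≡⟨ cong (_+ cornerRank c) same ⟩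
        coRankFrom c (i′ , j′) + cornerRank c ≡⟨ coRank-split c d′ (proj₂ (to (T-block {c} {b} {i′} {j′}) blk′)) ⟨
        coRank (i′ , j′)                      ∎)
        where open ≡-Reasoning
      bounded : ∀ {s} → InBlock s → coRankFrom c s < suc b ∸ rowFrom c
      bounded {i , j} (_ , blk) =
        let (i≤b , a≤i , _) = to (T-block {c} {b} {i} {j}) blk in coRankFrom-< c {j = j} a≤i i≤b

    A-R-rowInvariant : ∀ {m} → n ≡ suc m → RowInvariant m (A-R w)
    A-R-rowInvariant n≡ = record
      { inDiagram  = All.lookup (proj₁ A-R-unlinked)
      ; rowUnique  = λ {s} _ _ _ m<s → ⊥-elim (<⇒≱ (subst (toℕ (proj₁ s) <_) n≡ (toℕ<n (proj₁ s))) m<s)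
      ; blockBound = λ c b _ → A-R-blockBound c b
      }

    module MoveRow {r : ℕ} {x : Fin n} {L : List (Square n)}
                   (x≡ : toℕ x ≡ suc r) (inv : RowInvariant (suc r) L) where
      open RowInvariant inv

      R K : List (Square n)
      R = filterᵇ (onRow x) L
      K = filterᵇ (λ s → not (onRow x s)) L

      R⊆ : ∀ {s} → s ∈ R → s ∈ L × proj₁ s ≡ x
      R⊆ {s} s∈R = Data.Product.map₂ (to (T-onRow {x} {s})) (∈-filter⁻ (T? ∘ onRow x) {xs = L} s∈R)

      K⊆ : ∀ {s} → s ∈ K → s ∈ L × proj₁ s ≢ x
      K⊆ {s} s∈K = Data.Product.map₂ (λ t → to T-not t ∘ from (T-onRow {x} {s}))
                                     (∈-filter⁻ (T? ∘ (not ∘ onRow x)) {xs = L} s∈K)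

      invariant-≤1 : length (sortR w R) ≤ 1 → RowInvariant r L
      invariant-≤1 short = record
        { inDiagram  = inDiagram
        ; rowUnique  = rowUnique′
        ; blockBound = λ c b b≤r → blockBound c b (m≤n⇒m≤1+n b≤r)
        }
        where
        ∈R : ∀ {s} → s ∈ L → toℕ (proj₁ s) ≡ suc r → s ∈ R
        ∈R s∈L row = ∈-filter⁺ (T? ∘ onRow x) s∈L (from T-≡ᵇ (trans row (sym x≡)))
        rowUnique′ : ∀ {s t} → s ∈ L → t ∈ L → proj₁ s ≡ proj₁ t → r < toℕ (proj₁ s) → s ≡ t
        rowUnique′ s∈ t∈ same r<s with m≤n⇒m<n∨m≡n r<s
        ... | inj₁ r+1<s = rowUnique s∈ t∈ same r+1<s
        ... | inj₂ r+1≡s = ∈-length≤1 (subst (_≤ 1) (↭-length (sortR-↭ R)) short)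
                             (∈R s∈ (sym r+1≡s)) (∈R t∈ (trans (cong toℕ (sym same)) (sym r+1≡s)))

      module Moved {s₁ : Square n} {rest : List (Square n)} (sorted : sortR w R ≡ s₁ ∷ rest) where

        L′ : List (Square n)
        L′ = K ++ s₁ ∷ map up rest

        S↭R : s₁ ∷ rest ↭ R
        S↭R = subst (_↭ R) sorted (sortR-↭ R)

        S⊆ : ∀ {y} → y ∈ s₁ ∷ rest → y ∈ L × proj₁ y ≡ x
        S⊆ = R⊆ ∘ ∈-resp-↭ S↭R

        S-row : ∀ {y} → y ∈ s₁ ∷ rest → toℕ (proj₁ y) ≡ suc r
        S-row y∈ = trans (cong toℕ (proj₂ (S⊆ y∈))) x≡

        moved-row : ∀ {s} → s ∈ map up rest → toℕ (proj₁ s) ≡ r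
        moved-row s∈ with ∈-map⁻ up s∈
        ... | _ , y∈ , refl = toℕ-pred (S-row (there y∈))

        headFirst : ∀ c → HeadFirst (quadrantᵇ c) (s₁ ∷ rest)
        headFirst c = subst (HeadFirst (quadrantᵇ c)) sorted (sortR-headFirst (quadrantᵇ c) OnRow first
          (All.tabulate (λ s∈R → Data.Product.map₁ inDiagram (R⊆ s∈R))))
          where
          OnRow : Square n → Set
          OnRow y = T (inDᵇ w y) × proj₁ y ≡ x
          first : ∀ {y z} → OnRow y → OnRow z → T (quadrantᵇ c y) → ¬ T (quadrantᵇ c z) →
                  T (precR w y z) × ¬ T (precR w z y)
          first {_ , j} {_ , j′} (d , refl) (d′ , refl) qy ¬qz =
            quadrant-first c d d′ (to (T-quadrant {c} {x} {j}) qy) (¬qz ∘ from (T-quadrant {c} {x} {j′}))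

        count-L : ∀ p → count p L ≡ count p K + count p (s₁ ∷ rest)
        count-L p = trans (count-partition p (onRow x) L)
                          (trans (+-comm _ (count p K)) (cong (count p K +_) (sym (count-↭ p S↭R))))

        low-blocks-miss-S : ∀ c {b y} → b ≤ r → y ∈ s₁ ∷ rest → ¬ T (blockᵇ c b y)
        low-blocks-miss-S c {b} {i , j} b≤r y∈ t =
          <⇒≱ (s≤s b≤r) (subst (_≤ b) (S-row y∈) (proj₁ (to (T-block {c} {b} {i} {j}) t)))

        count-L-low : ∀ c {b} → b ≤ r → count (blockᵇ c b) L ≡ count (blockᵇ c b) K
        count-L-low c {b} b≤r = begin
          count B L                         ≡⟨ count-L B ⟩
          count B K + count B (s₁ ∷ rest)   ≡⟨ cong (count B K +_) S-outside ⟩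
          count B K + 0                     ≡⟨ +-identityʳ _ ⟩
          count B K                         ∎
          where
          open ≡-Reasoning
          B = blockᵇ c b
          S-outside = count-none B (s₁ ∷ rest) (low-blocks-miss-S c b≤r)

        count-L′-low : ∀ c {b} → b ≤ r →
                       count (blockᵇ c b) L′ ≡ count (blockᵇ c b) L + count (blockᵇ c b) (map up rest)
        count-L′-low c {b} b≤r = begin
          count B L′                               ≡⟨ count-++ B K _ ⟩
          count B K + count B (s₁ ∷ map up rest)   ≡⟨ cong₂ _+_ (sym (count-L-low c b≤r)) s₁-rejected ⟩
          count B L + count B (map up rest)        ∎
          where
          open ≡-Reasoning
          B = blockᵇ c b
          s₁-rejected = count-∷-reject B {s₁} (map up rest) (low-blocks-miss-S c b≤r (here refl))

        block-extend : ∀ c →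
          count (blockᵇ c (suc r)) L ≡ count (blockᵇ c r) K + count (quadrantᵇ c) (s₁ ∷ rest)
        block-extend c = trans (count-L _) (cong₂ _+_ (count-cong _ _ K on-K) (count-cong _ _ (s₁ ∷ rest) on-S))
          where
          on-K : ∀ {y} → y ∈ K → T (blockᵇ c (suc r) y) ⇔ T (blockᵇ c r y)
          on-K {i , j} y∈K = mk⇔ (block-rows {c} {suc r} {r} {i} {j} λ i≤r+1 → ≤-pred (≤∧≢⇒< i≤r+1 i≢))
                                 (block-rows {c} {r} {suc r} {i} {j} m≤n⇒m≤1+n)
            where
            i≢ : toℕ i ≢ suc r
            i≢ i≡ = proj₂ (K⊆ y∈K) (toℕ-injective (trans i≡ (sym x≡)))
          on-S : ∀ {y} → y ∈ s₁ ∷ rest → T (blockᵇ c (suc r) y) ⇔ T (quadrantᵇ c y)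
          on-S {i , j} y∈ = mk⇔ (block⇒quadrant {c} {suc r} {i , j})
                                (quadrant⇒block {c} {suc r} {i} {j} (≤-reflexive (S-row y∈)))

        rest-left-of-corner : ∀ {y} → y ∈ rest → ¬ Quadrant (just (pred x)) y
        rest-left-of-corner {i , j} y∈ q = <⇒≱ (s≤s (count-some (quadrantᵇ c) y∈ qy)) (begin
          suc (count (quadrantᵇ c) rest)                              ≡⟨ s₁-first ⟨
          count (quadrantᵇ c) (s₁ ∷ rest)                             ≤⟨ m≤n+m _ _ ⟩
          count (blockᵇ c r) K + count (quadrantᵇ c) (s₁ ∷ rest)      ≡⟨ block-extend c ⟨
          count (blockᵇ c (suc r)) L                                  ≤⟨ blockBound c (suc r) ≤-refl ⟩
          suc (suc r) ∸ suc (toℕ (pred x))                            ≡⟨ cong (suc r ∸_) (toℕ-pred x≡) ⟩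
          suc r ∸ r                                                   ≡⟨ m+n∸n≡m 1 r ⟩
          1                                                           ∎)
          where
          open ≤-Reasoning
          c = just (pred x)
          qy = from (T-quadrant {c} {i} {j}) q
          s₁-first = count-∷-accept (quadrantᵇ c) {s₁} rest (headFirst c y∈ qy)

        inDiagram′ : ∀ {s} → s ∈ L′ → T (inDᵇ w s)
        inDiagram′ s∈ with ∈-++⁻ K s∈
        ... | inj₁ s∈K         = inDiagram (proj₁ (K⊆ s∈K))
        ... | inj₂ (here refl) = inDiagram (proj₁ (S⊆ (here refl)))
        ... | inj₂ (there s∈)  with ∈-map⁻ up s∈
        ...   | (i , j) , y∈ , refl with S⊆ (there y∈)
        ...     | y∈L , refl = up-inD x≡ (inDiagram y∈L) (rest-left-of-corner y∈)

        ∈L′ : ∀ {s} → s ∈ L′ → (s ∈ L × proj₁ s ≢ x) ⊎ s ≡ s₁ ⊎ toℕ (proj₁ s) ≡ r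
        ∈L′ s∈ with ∈-++⁻ K s∈
        ... | inj₁ s∈K         = inj₁ (K⊆ s∈K)
        ... | inj₂ (here refl) = inj₂ (inj₁ refl)
        ... | inj₂ (there s∈)  = inj₂ (inj₂ (moved-row s∈))

        rowUnique′ : ∀ {s t} → s ∈ L′ → t ∈ L′ → proj₁ s ≡ proj₁ t → r < toℕ (proj₁ s) → s ≡ t
        rowUnique′ s∈ t∈ same r<s with ∈L′ s∈ | ∈L′ t∈
        ... | inj₂ (inj₂ s-row) | _ = ⊥-elim (<-irrefl (sym s-row) r<s)
        ... | _ | inj₂ (inj₂ t-row) = ⊥-elim (<-irrefl (sym (trans (cong toℕ same) t-row)) r<s)
        ... | inj₁ (s∈L , s≢x) | inj₁ (t∈L , _) =
          rowUnique s∈L t∈L same (≤∧≢⇒< r<s λ r+1≡s → s≢x (toℕ-injective (trans (sym r+1≡s) (sym x≡))))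
        ... | inj₁ (_ , s≢x) | inj₂ (inj₁ refl) = ⊥-elim (s≢x (trans same (proj₂ (S⊆ (here refl)))))
        ... | inj₂ (inj₁ refl) | inj₁ (_ , t≢x) = ⊥-elim (t≢x (trans (sym same) (proj₂ (S⊆ (here refl)))))
        ... | inj₂ (inj₁ refl) | inj₂ (inj₁ refl) = refl

        moved-quadrant : ∀ c → count (blockᵇ c r) (map up rest) ≤ count (quadrantᵇ c) rest
        moved-quadrant c = ≤-trans (≤-reflexive (count-map (blockᵇ c r) up rest)) (count-mono _ _ rest lift)
          where
          lift : ∀ {y} → y ∈ rest → T (blockᵇ c r (up y)) → T (quadrantᵇ c y)
          lift {i , j} y∈ t =
            let (a≤r , col) = to (T-quadrant {c} {pred i} {j}) (block⇒quadrant {c} {r} {up (i , j)} t)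
                i≡ = S-row (there y∈)
                r≤i = subst (r ≤_) (sym i≡) (n≤1+n r)
            in from (T-quadrant {c} {i} {j}) (≤-trans a≤r (≤-trans (≤-reflexive (toℕ-pred i≡)) r≤i) , col)

        new-row-bound : ∀ c → count (blockᵇ c r) L + count (quadrantᵇ c) rest ≤ suc r ∸ rowFrom c
        new-row-bound c with T? (quadrantᵇ c s₁)
        ... | yes q₁ = ≤-pred-∸ (suc r) (rowFrom c) (begin
          suc (count (blockᵇ c r) L + count (quadrantᵇ c) rest)  ≡⟨ +-suc _ _ ⟨
          count (blockᵇ c r) L + suc (count (quadrantᵇ c) rest)  ≡⟨ cong₂ _+_ (sym (count-L-low c ≤-refl)) s₁-counted ⟨
          count (blockᵇ c r) K + count (quadrantᵇ c) (s₁ ∷ rest) ≡⟨ block-extend c ⟨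
          count (blockᵇ c (suc r)) L                             ≤⟨ blockBound c (suc r) ≤-refl ⟩
          suc (suc r) ∸ rowFrom c                                ∎)
          where
          open ≤-Reasoning
          s₁-counted = count-∷-accept (quadrantᵇ c) {s₁} rest q₁
        ... | no ¬q₁ = begin
          count (blockᵇ c r) L + count (quadrantᵇ c) rest  ≡⟨ cong (count (blockᵇ c r) L +_) rest-outside ⟩
          count (blockᵇ c r) L + 0                         ≡⟨ +-identityʳ _ ⟩
          count (blockᵇ c r) L                             ≤⟨ blockBound c r (n≤1+n r) ⟩
          suc r ∸ rowFrom c                                ∎
          where
          open ≤-Reasoning
          rest-outside = count-none _ rest (λ y∈ qy → ¬q₁ (headFirst c y∈ qy))

        blockBound′ : ∀ c b → b ≤ r → count (blockᵇ c b) L′ ≤ suc b ∸ rowFrom c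
        blockBound′ c b b≤r with m≤n⇒m<n∨m≡n b≤r
        ... | inj₁ b<r = begin
          count (blockᵇ c b) L′                                    ≡⟨ count-L′-low c b≤r ⟩
          count (blockᵇ c b) L + count (blockᵇ c b) (map up rest)  ≡⟨ cong (count (blockᵇ c b) L +_) moved-none ⟩
          count (blockᵇ c b) L + 0                                 ≡⟨ +-identityʳ _ ⟩
          count (blockᵇ c b) L                                     ≤⟨ blockBound c b (m≤n⇒m≤1+n b≤r) ⟩
          suc b ∸ rowFrom c                                        ∎
          where
          open ≤-Reasoning
          moved-none : count (blockᵇ c b) (map up rest) ≡ 0
          moved-none = count-none (blockᵇ c b) (map up rest) λ { {i , j} s∈ t →
            <⇒≱ b<r (subst (_≤ b) (moved-row s∈) (proj₁ (to (T-block {c} {b} {i} {j}) t))) }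
        ... | inj₂ refl = begin
          count (blockᵇ c r) L′                                    ≡⟨ count-L′-low c ≤-refl ⟩
          count (blockᵇ c r) L + count (blockᵇ c r) (map up rest)  ≤⟨ +-monoʳ-≤ _ (moved-quadrant c) ⟩
          count (blockᵇ c r) L + count (quadrantᵇ c) rest          ≤⟨ new-row-bound c ⟩
          suc r ∸ rowFrom c                                        ∎
          where open ≤-Reasoning

        invariant : RowInvariant r L′
        invariant = record { inDiagram = inDiagram′ ; rowUnique = rowUnique′ ; blockBound = blockBound′ }

    moveRow-invariant : ∀ {r x L} → toℕ x ≡ suc r → RowInvariant (suc r) L → RowInvariant r (moveRow w x L)
    moveRow-invariant {r} {x} {L} x≡ inv with sortR w (filterᵇ (λ s → proj₁ s =F x) L) in sorted
    ... | []        = MoveRow.invariant-≤1 x≡ inv (subst (λ l → length l ≤ 1) (sym sorted) z≤n)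
    ... | _ ∷ []    = MoveRow.invariant-≤1 x≡ inv (subst (λ l → length l ≤ 1) (sym sorted) (s≤s z≤n))
    ... | _ ∷ _ ∷ _ = MoveRow.Moved.invariant x≡ inv sorted

    -- Definitionally the step function of the fold defining A'-R.
    processRow : List (Square n) → Fin n → List (Square n)
    processRow A x = if toℕ x ≡ᵇ 0 then A else moveRow w x A

    processRow-at : ∀ {A x k} → toℕ x ≡ k → processRow A x ≡ (if k ≡ᵇ 0 then A else moveRow w x A)
    processRow-at = cong (λ k → if k ≡ᵇ 0 then _ else _)

    processRows-invariant : ∀ {r L} xs → map toℕ xs ≡ downFrom (suc r) → RowInvariant r L →
                            RowInvariant 0 (foldl processRow L xs)
    processRows-invariant {zero}  (x ∷ []) rows inv =
      subst (RowInvariant 0) (sym (processRow-at (proj₁ (∷-injective rows)))) inv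
    processRows-invariant {suc r} (x ∷ xs) rows inv =
      subst (λ A → RowInvariant 0 (foldl processRow A xs)) (sym (processRow-at x≡))
            (processRows-invariant xs (proj₂ (∷-injective rows)) (moveRow-invariant x≡ inv))
      where
      x≡ : toℕ x ≡ suc r
      x≡ = proj₁ (∷-injective rows)

    A'-R-rowInvariant : ∀ {m} → n ≡ suc m → RowInvariant 0 (A'-R w)
    A'-R-rowInvariant n≡ = processRows-invariant (reverse (allFin n))
      (trans (map-toℕ-reverse-allFin n) (cong downFrom n≡)) (A-R-rowInvariant n≡)

lemma4p5 : (n : ℕ) (w : Permutation′ n) → Vexillary w →
    ((s : Square n) → s ∈ A'-R w → InD w s) ×
    ((s t : Square n) → s ∈ A'-R w → t ∈ A'-R w → proj₁ s ≡ proj₁ t → s ≡ t)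
lemma4p5 zero    w vex = (λ { (() , _) _ }) , (λ { (() , _) _ _ _ _ })
lemma4p5 (suc m) w vex = (λ _ s∈ → to T-≡ (inDiagram s∈)) , (λ _ _ → RowInvariant-0⇒rowUnique w inv)
  where
  inv : RowInvariant w 0 (A'-R w)
  inv = A'-R-rowInvariant w vex refl
  open RowInvariant inv
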